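{- Let $r,t$ be positive integers and $x$ an integer with $0\le x\le r-1$. If an $r$-graph $\mathcal{H}$ is simultaneously $\mathscr{G}_r(tr+x,\,t+2)$-free and $\mathscr{G}_r(2r-x-1,\,2)$-free, then $\mathcal{H}$ is $t$-cancellative.
   Context: An $r$-graph is a family of distinct $r$-element subsets (edges) of a finite vertex set. For integers $v,e$, an $r$-graph is $\mathscr{G}_r(v,e)$-free if the union of any $e$ distinct edges contains at least $v+1$ vertices. An $r$-graph $\mathcal{H}$ is $t$-cancellative if for any $t+2$ distinct edges $A_1,\dots,A_t,B,C\in\mathcal{H}$ one has $(\cup_{i=1}^t A_i)\cup B\neq(\cup_{i=1}^t A_i)\cup C$. -}

module Defs where

open import Data.Nat using (ℕ; suc; _≤_)
open import Data.Fin.Subset using (Subset; ⋃; _∪_; ∣_∣)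
open import Data.List using (List; _∷_; length)
open import Data.List.Membership.Propositional using (_∈_)
open import Data.List.Relation.Unary.All using (All)
open import Data.List.Relation.Unary.Unique.Propositional using (Unique)
open import Data.Product using (_×_)
open import Relation.Binary.PropositionalEquality using (_≡_; _≢_)

record RGraph (n r : ℕ) : Set where
  field
    edges    : List (Subset n)
    distinct : Unique edges
    uniform  : All (λ A → ∣ A ∣ ≡ r) edges
open RGraph public

GFree : ∀ {n r} → ℕ → ℕ → RGraph n r → Set
GFree v e H = ∀ (L : List (Subset _)) →
  All (_∈ edges H) L → Unique L → length L ≡ e → suc v ≤ ∣ ⋃ L ∣

Cancellative : ∀ {n r} → ℕ → RGraph n r → Set
Cancellative t H = ∀ (As : List (Subset _)) (B C : Subset _) →
  All (_∈ edges H) (B ∷ C ∷ As) → Unique (B ∷ C ∷ As) → length As ≡ t →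
  (⋃ As ∪ B) ≢ (⋃ As ∪ C)

module Submission where

-- Let U = A₁ ∪ … ∪ A_t and suppose U ∪ B = U ∪ C for distinct
-- edges A₁,…,A_t,B,C.  Then B ∖ C and C ∖ B both lie in U, so the union of
-- all t+2 edges lies in U ∪ (B ∩ C) and has at most t·r + ∣B ∩ C∣ vertices.
--   * If ∣B ∩ C∣ ≤ x, these t+2 edges span at most t·r + x vertices,
--     contradicting G_r(tr+x, t+2)-freeness.
--   * If ∣B ∩ C∣ ≥ x+1, inclusion–exclusion gives
--     ∣B ∪ C∣ = 2r − ∣B ∩ C∣ ≤ 2r − x − 1, contradicting
--     G_r(2r−x−1, 2)-freeness.

open import Defs
open import Data.Nat using (ℕ; suc; _+_; _*_; _∸_; _<_; _≤_; _≤?_)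
open import Data.Nat.Properties
open import Data.Bool using (true; false)
open import Data.Vec using ([]; _∷_)
open import Data.Fin.Subset using (Subset; ⋃; _∪_; _∩_; _∈_; _⊆_; ∣_∣; ⊥)
open import Data.Fin.Subset.Properties
  using (∣⊥∣≡0; ∪-identityʳ; p⊆q⇒∣p∣≤∣q∣; x∈p∪q⁺; x∈p∪q⁻; x∈p∩q⁺)
open import Data.List using (List; []; _∷_; length)
open import Data.List.Relation.Unary.All as All using (All; []; _∷_)
open import Data.List.Relation.Unary.AllPairs using ([]; _∷_)
open import Data.Product using (_,_)
open import Data.Sum using (inj₁; inj₂)
open import Relation.Binary.PropositionalEquality
open import Relation.Nullary using (yes; no)

∣p∪q∣+∣p∩q∣≡∣p∣+∣q∣ : ∀ {n} (p q : Subset n) → ∣ p ∪ q ∣ + ∣ p ∩ q ∣ ≡ ∣ p ∣ + ∣ q ∣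
∣p∪q∣+∣p∩q∣≡∣p∣+∣q∣ [] [] = refl
∣p∪q∣+∣p∩q∣≡∣p∣+∣q∣ (true ∷ p) (true ∷ q) = cong suc (begin
  ∣ p ∪ q ∣ + suc ∣ p ∩ q ∣   ≡⟨ +-suc _ _ ⟩
  suc (∣ p ∪ q ∣ + ∣ p ∩ q ∣) ≡⟨ cong suc (∣p∪q∣+∣p∩q∣≡∣p∣+∣q∣ p q) ⟩
  suc (∣ p ∣ + ∣ q ∣)         ≡⟨ +-suc _ _ ⟨
  ∣ p ∣ + suc ∣ q ∣           ∎)
  where open ≡-Reasoning
∣p∪q∣+∣p∩q∣≡∣p∣+∣q∣ (true ∷ p) (false ∷ q) = cong suc (∣p∪q∣+∣p∩q∣≡∣p∣+∣q∣ p q)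
∣p∪q∣+∣p∩q∣≡∣p∣+∣q∣ (false ∷ p) (true ∷ q) =
  trans (cong suc (∣p∪q∣+∣p∩q∣≡∣p∣+∣q∣ p q)) (sym (+-suc _ _))
∣p∪q∣+∣p∩q∣≡∣p∣+∣q∣ (false ∷ p) (false ∷ q) = ∣p∪q∣+∣p∩q∣≡∣p∣+∣q∣ p q

∣p∪q∣≤∣p∣+∣q∣ : ∀ {n} (p q : Subset n) → ∣ p ∪ q ∣ ≤ ∣ p ∣ + ∣ q ∣
∣p∪q∣≤∣p∣+∣q∣ p q =
  ≤-trans (m≤m+n ∣ p ∪ q ∣ ∣ p ∩ q ∣) (≤-reflexive (∣p∪q∣+∣p∩q∣≡∣p∣+∣q∣ p q))

∣⋃∣≤length*r : ∀ {n} r (As : List (Subset n)) →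
  All (λ A → ∣ A ∣ ≡ r) As → ∣ ⋃ As ∣ ≤ length As * r
∣⋃∣≤length*r {n} r [] [] = ≤-reflexive (∣⊥∣≡0 n)
∣⋃∣≤length*r r (A ∷ As) (∣A∣≡r ∷ sizes) =
  ≤-trans (∣p∪q∣≤∣p∣+∣q∣ A (⋃ As))
          (+-mono-≤ (≤-reflexive ∣A∣≡r) (∣⋃∣≤length*r r As sizes))

-- If u ∪ b = u ∪ c, then b and c differ only inside u, so b ∪ c ∪ u is
-- covered by u together with the common part b ∩ c.
∪-cancel⇒⊆ : ∀ {n} (u b c : Subset n) →
  u ∪ b ≡ u ∪ c → b ∪ (c ∪ u) ⊆ u ∪ (b ∩ c)
∪-cancel⇒⊆ u b c u∪b≡u∪c {i} i∈b∪c∪u with x∈p∪q⁻ b (c ∪ u) i∈b∪c∪u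
... | inj₁ i∈b with x∈p∪q⁻ u c (subst (i ∈_) u∪b≡u∪c (x∈p∪q⁺ (inj₂ i∈b)))
...   | inj₁ i∈u = x∈p∪q⁺ (inj₁ i∈u)
...   | inj₂ i∈c = x∈p∪q⁺ (inj₂ (x∈p∩q⁺ (i∈b , i∈c)))
∪-cancel⇒⊆ u b c u∪b≡u∪c {i} _ | inj₂ i∈c∪u with x∈p∪q⁻ c u i∈c∪u
... | inj₂ i∈u = x∈p∪q⁺ (inj₁ i∈u)
... | inj₁ i∈c with x∈p∪q⁻ u b (subst (i ∈_) (sym u∪b≡u∪c) (x∈p∪q⁺ (inj₂ i∈c)))
...   | inj₁ i∈u = x∈p∪q⁺ (inj₁ i∈u)
...   | inj₂ i∈b = x∈p∪q⁺ (inj₂ (x∈p∩q⁺ (i∈b , i∈c)))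

cancelling-union-size : ∀ {n} r t (As : List (Subset n)) (B C : Subset n) →
  All (λ A → ∣ A ∣ ≡ r) As → length As ≡ t →
  ⋃ As ∪ B ≡ ⋃ As ∪ C → ∣ ⋃ (B ∷ C ∷ As) ∣ ≤ t * r + ∣ B ∩ C ∣
cancelling-union-size r t As B C sizes refl cancel = begin
  ∣ B ∪ (C ∪ ⋃ As) ∣           ≤⟨ p⊆q⇒∣p∣≤∣q∣ (∪-cancel⇒⊆ (⋃ As) B C cancel) ⟩
  ∣ ⋃ As ∪ (B ∩ C) ∣           ≤⟨ ∣p∪q∣≤∣p∣+∣q∣ (⋃ As) (B ∩ C) ⟩
  ∣ ⋃ As ∣ + ∣ B ∩ C ∣         ≤⟨ +-monoˡ-≤ ∣ B ∩ C ∣ (∣⋃∣≤length*r r As sizes) ⟩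
  length As * r + ∣ B ∩ C ∣    ∎
  where open ≤-Reasoning

pair-union-size : ∀ {n} r (B C : Subset n) → ∣ B ∣ ≡ r → ∣ C ∣ ≡ r →
  ∣ ⋃ (B ∷ C ∷ []) ∣ + ∣ B ∩ C ∣ ≡ 2 * r
pair-union-size r B C ∣B∣≡r ∣C∣≡r = begin
  ∣ B ∪ (C ∪ ⊥) ∣ + ∣ B ∩ C ∣ ≡⟨ cong (λ D → ∣ B ∪ D ∣ + ∣ B ∩ C ∣) (∪-identityʳ C) ⟩
  ∣ B ∪ C ∣ + ∣ B ∩ C ∣       ≡⟨ ∣p∪q∣+∣p∩q∣≡∣p∣+∣q∣ B C ⟩
  ∣ B ∣ + ∣ C ∣               ≡⟨ cong₂ _+_ ∣B∣≡r (trans ∣C∣≡r (sym (+-identityʳ r))) ⟩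
  2 * r                       ∎
  where open ≡-Reasoning

≤∸-of-sum : ∀ {m k N} x → m + k ≡ N → suc x ≤ k → m ≤ N ∸ x ∸ 1
≤∸-of-sum {m} {k} {N} x m+k≡N x<k = begin
  m               ≤⟨ m+n≤o⇒m≤o∸n m (≤-trans (+-monoʳ-≤ m x+1≤k) (≤-reflexive m+k≡N)) ⟩
  N ∸ (x + 1)     ≡⟨ ∸-+-assoc N x 1 ⟨
  N ∸ x ∸ 1       ∎
  where
  open ≤-Reasoning
  x+1≤k : x + 1 ≤ k
  x+1≤k = subst (_≤ k) (+-comm 1 x) x<k

mainTheorem5 : ∀ (n r t x : ℕ) → 1 ≤ r → 1 ≤ t → x < r →
    (H : RGraph n r) →
    GFree (t * r + x) (t + 2) H →
    GFree (2 * r ∸ x ∸ 1) 2 H →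
    Cancellative t H
mainTheorem5 _ r t x _ _ _ H free-t+2 free-2 As B C
  edges@(B∈H ∷ C∈H ∷ As∈H) distinct@((B≢C ∷ _) ∷ _) length≡t cancel
  with ∣ B ∩ C ∣ ≤? x
... | yes ∣B∩C∣≤x = <⇒≱ many-points few-points
  where
  many-points : t * r + x < ∣ ⋃ (B ∷ C ∷ As) ∣
  many-points = free-t+2 (B ∷ C ∷ As) edges distinct
    (trans (cong (λ k → suc (suc k)) length≡t) (+-comm 2 t))
  few-points : ∣ ⋃ (B ∷ C ∷ As) ∣ ≤ t * r + x
  few-points = ≤-trans
    (cancelling-union-size r t As B C (All.map (All.lookup (uniform H)) As∈H) length≡t cancel)
    (+-monoʳ-≤ (t * r) ∣B∩C∣≤x)
... | no ∣B∩C∣≰x = <⇒≱ many-points few-points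
  where
  many-points : 2 * r ∸ x ∸ 1 < ∣ ⋃ (B ∷ C ∷ []) ∣
  many-points = free-2 (B ∷ C ∷ []) (B∈H ∷ C∈H ∷ []) ((B≢C ∷ []) ∷ [] ∷ []) refl
  few-points : ∣ ⋃ (B ∷ C ∷ []) ∣ ≤ 2 * r ∸ x ∸ 1
  few-points = ≤∸-of-sum x
    (pair-union-size r B C (All.lookup (uniform H) B∈H) (All.lookup (uniform H) C∈H))
    (≰⇒> ∣B∩C∣≰x)
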